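{- If $G$ is a randomly $3$-dimensional graph, then $\Delta(G)\leq 3$.
   Context: All graphs are finite, simple and connected; $\Delta(G)$ is the maximum degree. For an ordered set $W=\{w_1,\dots,w_k\}\subseteq V(G)$ and $v\in V(G)$, $r(v|W)=(d(v,w_1),\dots,d(v,w_k))$, where $d$ denotes graph distance. $W$ is a resolving set if distinct vertices have distinct representations with respect to $W$; a basis is a minimum-size resolving set and its size is the metric dimension $\beta(G)$. $G$ is randomly $k$-dimensional if $\beta(G)=k$ and every $k$-subset of $V(G)$ is a basis of $G$. -}

module Defs where

open import Data.Nat using (ℕ; zero; suc; _≤_)
open import Data.Bool using (Bool; true; false; _∨_; if_then_else_)
open import Data.Fin using (Fin)
open import Data.Fin.Subset using (Subset; _∈_; ∣_∣)
open import Data.Vec using (tabulate)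
open import Data.Bool.ListAction using (any)
open import Data.List.Base using (allFin)
open import Data.Fin.Properties using (_≟_)
open import Relation.Nullary.Decidable using (⌊_⌋)
open import Relation.Binary.PropositionalEquality using (_≡_)
open import Data.Product using (∃; _×_)

record Graph (n : ℕ) : Set where
  field
    adj     : Fin n → Fin n → Bool
    adj-sym : ∀ u v → adj u v ≡ adj v u
    adj-irr : ∀ v → adj v v ≡ false
open Graph public

module _ {n : ℕ} (G : Graph n) where

  -- reach k u v = true  iff  there is a walk from u to v of length at most k
  reach : ℕ → Fin n → Fin n → Bool
  reach zero    u v = ⌊ u ≟ v ⌋
  reach (suc k) u v = reach k u v ∨ any (λ w → if adj G u w then reach k w v else false) (allFin n)

  Connected : Set
  Connected = ∀ u v → ∃ λ k → reach k u v ≡ true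

-- least i in [j, j + b) with f i = true, or j + b if none
firstFrom : (ℕ → Bool) → ℕ → ℕ → ℕ
firstFrom f j zero    = j
firstFrom f j (suc b) = if f j then j else firstFrom f (suc j) b

module _ {n : ℕ} (G : Graph n) where

  -- graph distance: least k with a walk of length ≤ k (for connected graphs, d ≤ n - 1)
  dist : Fin n → Fin n → ℕ
  dist u v = firstFrom (λ k → reach G k u v) 0 n

  Resolving : Subset n → Set
  Resolving W = ∀ u v → (∀ w → w ∈ W → dist u w ≡ dist v w) → u ≡ v

  MetricDim : ℕ → Set
  MetricDim k = (∃ λ W → Resolving W × ∣ W ∣ ≡ k) × (∀ W → Resolving W → k ≤ ∣ W ∣)

  Basis : Subset n → Set
  Basis W = Resolving W × (∀ W' → Resolving W' → ∣ W ∣ ≤ ∣ W' ∣)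

  RandomlyDim : ℕ → Set
  RandomlyDim k = MetricDim k × (∀ W → ∣ W ∣ ≡ k → Basis W)

  degree : Fin n → ℕ
  degree v = ∣ tabulate (adj G v) ∣

  MaxDegreeAtMost : ℕ → Set
  MaxDegreeAtMost d = ∀ v → degree v ≤ d

-- Suppose a vertex v had four distinct neighbours.  Distances between two
-- of them are 1 or 2 according to whether they are adjacent, and their
-- distance to v is 1.  Every graph on four vertices either has two
-- vertices that see the other two alike (a twin pair), or is an induced
-- path P4; this is checked by exhaustive computation over all 64 labelled
-- graphs on four vertices.
--   * Twin pair a, b (with the other two neighbours c, e): a and b have
--     equal distances to the three vertices v, c, e, which form a basis.
--   * Induced path e₁ i₁ i₂ e₂: together with v it spans a gem.  Using
--     that triples resolve and pairs do not, one shows that exactly one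
--     vertex w lies outside the gem, that w is at distance 1 from i₁, i₂
--     and at distance 2 from e₁, e₂; then the distances to e₁, e₂ alone
--     tell all six vertices apart, contradicting β(G) = 3.
-- The file first develops walks and graph distance (the distance in Defs
-- is the least k admitting a walk of length ≤ k), then sizes of small
-- subsets, then the two consequences of random 3-dimensionality, the
-- four-vertex classification, the two obstructions, and finally the bound.

module Submission where

open import Defs
open import Data.Nat using (ℕ; zero; suc; _+_; _≤_; _<_; z≤n; s≤s; _<?_; _≤?_)
open import Data.Nat.Properties
  using (≤-trans; ≤-reflexive; ≤-antisym; <-irrefl; <-cmp; ≤⇒≯; ≮⇒≥; ≰⇒>; ≤∧≢⇒<;
         n≤1+n; m≤m+n; +-suc; +-identityʳ; n≤0⇒n≡0; suc-injective; <-≤-trans; ≤-<-trans)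
open import Data.Bool using (Bool; true; false; T; if_then_else_)
open import Data.Bool.Properties using (T-∨; T-≡) renaming (_≟_ to _≟ᵇ_)
open import Data.Fin using (Fin; zero; suc)
open import Data.Fin.Properties using (_≟_; any?) renaming (suc-injective to fsuc-injective)
open import Data.Fin.Subset using (Subset; inside; outside; _∈_; _∉_; ∣_∣; ⁅_⁆; _∪_)
open import Data.Fin.Subset.Properties using (x∈⁅x⁆; x∈⁅y⁆⇒x≡y; ∣⁅x⁆∣≡1; x∈p∪q⁺; x∈p∪q⁻; anySubset?)
open import Data.Vec using ([]; _∷_; tabulate; here; there)
open import Data.Vec.Properties using ([]=⇒lookup; lookup∘tabulate)
open import Data.List using (allFin)
open import Data.List.Relation.Unary.Any as Any using (satisfied)
open import Data.List.Relation.Unary.Any.Properties using (any⁺; any⁻)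
open import Data.List.Membership.Propositional.Properties using (∈-allFin)
open import Data.Product using (∃; _×_; _,_; proj₁; proj₂)
open import Data.Sum using (_⊎_; inj₁; inj₂; [_,_]′; map₂)
open import Data.Empty using (⊥; ⊥-elim)
open import Function using (_∘_; Injective)
open import Function.Bundles using (Equivalence)
open import Relation.Nullary using (¬_; ¬?; yes; no; contradiction)
open import Relation.Nullary.Decidable
  using (Dec; T?; _×-dec_; _⊎-dec_; toWitness; fromWitness; toWitnessFalse; decidable-stable)
open import Relation.Binary.Definitions using (tri<; tri≈; tri>)
open import Relation.Binary.PropositionalEquality
  using (_≡_; _≢_; refl; sym; trans; cong; cong₂; subst; ≢-sym; module ≡-Reasoning)

T-if⁺ : ∀ {b c} → T b → T c → T (if b then c else false)
T-if⁺ {true} _ tc = tc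

T-if⁻ : ∀ b {c} → T (if b then c else false) → T b × T c
T-if⁻ true tc = _ , tc

T-ext : ∀ {a b} → (T a → T b) → (T b → T a) → a ≡ b
T-ext {false} {false} _   _   = refl
T-ext {false} {true}  _   b⇒a = ⊥-elim (b⇒a _)
T-ext {true}  {false} a⇒b _   = ⊥-elim (a⇒b _)
T-ext {true}  {true}  _   _   = refl

exactlyOne : ∀ {x} → x ≤ 1 → x ≢ 0 → x ≡ 1
exactlyOne {zero} _ x≢0 = contradiction refl x≢0
exactlyOne {suc zero} _ _ = refl
exactlyOne {suc (suc _)} (s≤s ()) _

exactlyTwo : ∀ {x} → x ≤ 2 → x ≢ 0 → x ≢ 1 → x ≡ 2
exactlyTwo {zero} _ x≢0 _ = contradiction refl x≢0
exactlyTwo {suc zero} _ _ x≢1 = contradiction refl x≢1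
exactlyTwo {suc (suc zero)} _ _ _ = refl
exactlyTwo {suc (suc (suc _))} (s≤s (s≤s ())) _ _

Close : ℕ → ℕ → Set
Close a b = a ≤ suc b × b ≤ suc a

-- Two numbers close to each other and to t, but both different from t,
-- lie on the same side of t and are therefore equal.
close-off-centre : ∀ {a b t} → Close a t → Close b t → Close a b → a ≢ t → b ≢ t → a ≡ b
close-off-centre {a} {b} {t} (a≤t+1 , t≤a+1) (b≤t+1 , t≤b+1) (a≤b+1 , b≤a+1) a≢t b≢t
  with <-cmp a t | <-cmp b t
... | tri≈ _ a≡t _ | _            = contradiction a≡t a≢t
... | _            | tri≈ _ b≡t _ = contradiction b≡t b≢t
... | tri< a<t _ _ | tri< b<t _ _ = suc-injective (trans (≤-antisym a<t t≤a+1) (sym (≤-antisym b<t t≤b+1)))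
... | tri> _ _ t<a | tri> _ _ t<b = trans (≤-antisym a≤t+1 t<a) (sym (≤-antisym b≤t+1 t<b))
... | tri< a<t _ _ | tri> _ _ t<b = contradiction (<-≤-trans (≤-<-trans a<t t<b) b≤a+1) (<-irrefl refl)
... | tri> _ _ t<a | tri< b<t _ _ = contradiction (<-≤-trans (≤-<-trans b<t t<a) a≤b+1) (<-irrefl refl)

distinct⇒1<n : ∀ {n} {u w : Fin n} → u ≢ w → 1 < n
distinct⇒1<n {suc zero} {zero} {zero} u≢w = contradiction refl u≢w
distinct⇒1<n {suc (suc _)} _ = s≤s (s≤s z≤n)

inhabited⇒0<n : ∀ {n} → Fin n → 0 < n
inhabited⇒0<n {suc _} _ = s≤s z≤n

firstFrom-bound : ∀ f j b → firstFrom f j b ≤ j + b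
firstFrom-bound f j zero = ≤-reflexive (sym (+-identityʳ j))
firstFrom-bound f j (suc b) with f j
... | true  = m≤m+n j (suc b)
... | false = ≤-trans (firstFrom-bound f (suc j) b) (≤-reflexive (sym (+-suc j b)))

firstFrom-least : ∀ f j b {i} → j ≤ i → i < j + b → T (f i) → firstFrom f j b ≤ i
firstFrom-least f j zero j≤i i<j _ = contradiction (subst (_ <_) (+-identityʳ j) i<j) (≤⇒≯ j≤i)
firstFrom-least f j (suc b) {i} j≤i i<j+b fi with f j in fj
... | true  = j≤i
... | false = firstFrom-least f (suc j) b (≤∧≢⇒< j≤i j≢i) (subst (i <_) (+-suc j b) i<j+b) fi
  where
  j≢i : j ≢ i
  j≢i refl = subst T fj fi

firstFrom-found : ∀ f j b → firstFrom f j b < j + b → T (f (firstFrom f j b))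
firstFrom-found f j zero lt = contradiction lt (<-irrefl (sym (+-identityʳ j)))
firstFrom-found f j (suc b) lt with f j in fj
... | true  = subst T (sym fj) _
... | false = firstFrom-found f (suc j) b (subst (firstFrom f (suc j) b <_) (+-suc j b) lt)

firstFrom-cong : ∀ {f g} j b → (∀ i → f i ≡ g i) → firstFrom f j b ≡ firstFrom g j b
firstFrom-cong j zero f≗g = refl
firstFrom-cong {g = g} j (suc b) f≗g rewrite f≗g j with g j
... | true  = refl
... | false = firstFrom-cong (suc j) b f≗g

module Walks {n : ℕ} (G : Graph n) where

  adj-symᵀ : ∀ {u w} → T (adj G u w) → T (adj G w u)
  adj-symᵀ {u} {w} = subst T (adj-sym G u w)

  adj⇒≢ : ∀ {u w} → T (adj G u w) → u ≢ w
  adj⇒≢ {u} a refl = subst T (adj-irr G u) a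

  reach-zero : ∀ {u x} → T (reach G 0 u x) → u ≡ x
  reach-zero {u} {x} = toWitness {a? = u ≟ x}

  reach-refl : ∀ {u} → T (reach G 0 u u)
  reach-refl {u} = fromWitness {a? = u ≟ u} refl

  reach-suc⁻ : ∀ k {u x} → T (reach G (suc k) u x) →
               T (reach G k u x) ⊎ ∃ λ w → T (adj G u w) × T (reach G k w x)
  reach-suc⁻ k {u} r with Equivalence.to T-∨ r
  ... | inj₁ shorter = inj₁ shorter
  ... | inj₂ viaEdge with satisfied (any⁻ _ (allFin n) viaEdge)
  ... | w , t = inj₂ (w , T-if⁻ (adj G u w) t)

  reach-weaken : ∀ k {u x} → T (reach G k u x) → T (reach G (suc k) u x)
  reach-weaken k r = Equivalence.from T-∨ (inj₁ r)

  reach-via : ∀ k {u w x} → T (adj G u w) → T (reach G k w x) → T (reach G (suc k) u x)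
  reach-via k {w = w} a r =
    Equivalence.from T-∨ (inj₂ (any⁺ _ (Any.map (λ { refl → T-if⁺ a r }) (∈-allFin w))))

  reach-snoc : ∀ k {u y x} → T (reach G k u y) → T (adj G y x) → T (reach G (suc k) u x)
  reach-snoc zero r a with reach-zero r
  ... | refl = reach-via zero a reach-refl
  reach-snoc (suc k) r a with reach-suc⁻ k r
  ... | inj₁ r′ = reach-weaken (suc k) (reach-snoc k r′ a)
  ... | inj₂ (w , uw , r′) = reach-via (suc k) uw (reach-snoc k r′ a)

  reach-sym : ∀ k {u x} → T (reach G k u x) → T (reach G k x u)
  reach-sym zero r with reach-zero r
  ... | refl = r
  reach-sym (suc k) r with reach-suc⁻ k r
  ... | inj₁ r′ = reach-weaken k (reach-sym k r′)
  ... | inj₂ (w , uw , r′) = reach-snoc k (reach-sym k r′) (adj-symᵀ uw)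

module Distance {n : ℕ} (G : Graph n) where

  open Walks G public

  d : Fin n → Fin n → ℕ
  d = dist G

  dist-least : ∀ {k u w} → T (reach G k u w) → d u w ≤ k
  dist-least {k} {u} {w} r with k <? n
  ... | yes k<n = firstFrom-least (λ i → reach G i u w) 0 n z≤n k<n r
  ... | no  k≮n = ≤-trans (firstFrom-bound (λ i → reach G i u w) 0 n) (≮⇒≥ k≮n)

  dist-bound : ∀ u w → d u w ≤ n
  dist-bound u w = firstFrom-bound (λ i → reach G i u w) 0 n

  dist-reaches : ∀ {u w k} → d u w ≡ k → k < n → T (reach G k u w)
  dist-reaches {u} {w} refl k<n = firstFrom-found (λ i → reach G i u w) 0 n k<n

  dist-sym : ∀ u w → d u w ≡ d w u
  dist-sym u w = firstFrom-cong 0 n (λ k → T-ext (reach-sym k) (reach-sym k))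

  dist-refl : ∀ u → d u u ≡ 0
  dist-refl u = n≤0⇒n≡0 (dist-least reach-refl)

  dist-zero : ∀ {u w} → d u w ≡ 0 → u ≡ w
  dist-zero {u} e = reach-zero (dist-reaches e (inhabited⇒0<n u))

  dist-adj : ∀ {u w} → T (adj G u w) → d u w ≡ 1
  dist-adj a = exactlyOne (dist-least (reach-snoc 0 reach-refl a)) (adj⇒≢ a ∘ dist-zero)

  dist-one : ∀ {u w} → d u w ≡ 1 → T (adj G u w)
  dist-one {u} {w} e = edge (reach-suc⁻ 0 (dist-reaches e (distinct⇒1<n u≢w)))
    where
    u≢w : u ≢ w
    u≢w refl = contradiction (trans (sym e) (dist-refl u)) λ ()
    edge : T (reach G 0 u w) ⊎ ∃ (λ y → T (adj G u y) × T (reach G 0 y w)) → T (adj G u w)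
    edge (inj₁ r) = contradiction (reach-zero r) u≢w
    edge (inj₂ (y , uy , r)) = subst (λ z → T (adj G u z)) (reach-zero r) uy

  dist-two : ∀ {u w c} → u ≢ w → ¬ T (adj G u w) → T (adj G c u) → T (adj G c w) → d u w ≡ 2
  dist-two u≢w u≁w cu cw =
    exactlyTwo (dist-least (reach-snoc 1 (reach-snoc 0 reach-refl (adj-symᵀ cu)) cw))
               (u≢w ∘ dist-zero) (u≁w ∘ dist-one)

  dist-cone : ∀ {u w c} → T (adj G c u) → T (adj G c w) → u ≢ w →
              d u w ≡ (if adj G u w then 1 else 2)
  dist-cone {u} {w} cu cw u≢w with adj G u w in uw
  ... | true  = dist-adj (subst T (sym uw) _)
  ... | false = dist-two u≢w (subst T uw) cu cw

  dist-lipschitz : ∀ u {y x} → T (adj G y x) → d u x ≤ suc (d u y)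
  dist-lipschitz u {y} {x} a with d u y <? n
  ... | yes below = dist-least (reach-snoc (d u y) (dist-reaches refl below) a)
  ... | no  above = ≤-trans (dist-bound u x) (≤-trans (≮⇒≥ above) (n≤1+n _))

  dist-close : ∀ u {y x} → T (adj G y x) → Close (d u x) (d u y)
  dist-close u a = dist-lipschitz u a , dist-lipschitz u (adj-symᵀ a)

∣∪∣-disjoint : ∀ {n} (p q : Subset n) → (∀ {x} → x ∈ p → x ∉ q) → ∣ p ∪ q ∣ ≡ ∣ p ∣ + ∣ q ∣
∣∪∣-disjoint [] [] _ = refl
∣∪∣-disjoint (outside ∷ p) (outside ∷ q) disj = ∣∪∣-disjoint p q (λ x∈p → disj (there x∈p) ∘ there)
∣∪∣-disjoint (outside ∷ p) (inside ∷ q) disj =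
  trans (cong suc (∣∪∣-disjoint p q (λ x∈p → disj (there x∈p) ∘ there))) (sym (+-suc ∣ p ∣ ∣ q ∣))
∣∪∣-disjoint (inside ∷ p) (outside ∷ q) disj = cong suc (∣∪∣-disjoint p q (λ x∈p → disj (there x∈p) ∘ there))
∣∪∣-disjoint (inside ∷ p) (inside ∷ q) disj = contradiction here (disj here)

pairSet : ∀ {n} → Fin n → Fin n → Subset n
pairSet a b = ⁅ a ⁆ ∪ ⁅ b ⁆

tripleSet : ∀ {n} → Fin n → Fin n → Fin n → Subset n
tripleSet a b c = ⁅ a ⁆ ∪ pairSet b c

∈pairSet⁻ : ∀ {n} {x a b : Fin n} → x ∈ pairSet a b → x ≡ a ⊎ x ≡ b
∈pairSet⁻ {a = a} {b} x∈ with x∈p∪q⁻ ⁅ a ⁆ ⁅ b ⁆ x∈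
... | inj₁ x∈a = inj₁ (x∈⁅y⁆⇒x≡y a x∈a)
... | inj₂ x∈b = inj₂ (x∈⁅y⁆⇒x≡y b x∈b)

∈tripleSet⁻ : ∀ {n} {x a b c : Fin n} → x ∈ tripleSet a b c → x ≡ a ⊎ x ≡ b ⊎ x ≡ c
∈tripleSet⁻ {a = a} {b} {c} x∈ with x∈p∪q⁻ ⁅ a ⁆ (pairSet b c) x∈
... | inj₁ x∈a  = inj₁ (x∈⁅y⁆⇒x≡y a x∈a)
... | inj₂ x∈bc = inj₂ (∈pairSet⁻ x∈bc)

∣pairSet∣ : ∀ {n} {a b : Fin n} → a ≢ b → ∣ pairSet a b ∣ ≡ 2
∣pairSet∣ {a = a} {b} a≢b = begin
  ∣ ⁅ a ⁆ ∪ ⁅ b ⁆ ∣     ≡⟨ ∣∪∣-disjoint ⁅ a ⁆ ⁅ b ⁆ apart ⟩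
  ∣ ⁅ a ⁆ ∣ + ∣ ⁅ b ⁆ ∣ ≡⟨ cong₂ _+_ (∣⁅x⁆∣≡1 a) (∣⁅x⁆∣≡1 b) ⟩
  2                     ∎
  where
  open ≡-Reasoning
  apart : ∀ {x} → x ∈ ⁅ a ⁆ → x ∉ ⁅ b ⁆
  apart x∈a x∈b = a≢b (trans (sym (x∈⁅y⁆⇒x≡y a x∈a)) (x∈⁅y⁆⇒x≡y b x∈b))

∣tripleSet∣ : ∀ {n} {a b c : Fin n} → a ≢ b → a ≢ c → b ≢ c → ∣ tripleSet a b c ∣ ≡ 3
∣tripleSet∣ {a = a} {b} {c} a≢b a≢c b≢c = begin
  ∣ ⁅ a ⁆ ∪ pairSet b c ∣         ≡⟨ ∣∪∣-disjoint ⁅ a ⁆ (pairSet b c) apart ⟩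
  ∣ ⁅ a ⁆ ∣ + ∣ pairSet b c ∣     ≡⟨ cong₂ _+_ (∣⁅x⁆∣≡1 a) (∣pairSet∣ b≢c) ⟩
  3                               ∎
  where
  open ≡-Reasoning
  apart : ∀ {x} → x ∈ ⁅ a ⁆ → x ∉ pairSet b c
  apart x∈a x∈bc with x∈⁅y⁆⇒x≡y a x∈a | ∈pairSet⁻ x∈bc
  ... | refl | inj₁ x≡b = a≢b x≡b
  ... | refl | inj₂ x≡c = a≢c x≡c

extend : ∀ {k n} → (Fin k → Fin n) → Fin (suc k) → Fin (suc n)
extend f zero    = zero
extend f (suc i) = suc (f i)

extend-injective : ∀ {k n} {f : Fin k → Fin n} → Injective _≡_ _≡_ f → Injective _≡_ _≡_ (extend f)
extend-injective f-inj {zero}  {zero}  _ = refl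
extend-injective f-inj {suc i} {suc j} e = cong suc (f-inj (fsuc-injective e))

largeSubset⇒embedding : ∀ {n} k (p : Subset n) → k ≤ ∣ p ∣ →
  ∃ λ (f : Fin k → Fin n) → Injective _≡_ _≡_ f × (∀ i → f i ∈ p)
largeSubset⇒embedding zero p _ = (λ ()) , (λ { {()} }) , (λ ())
largeSubset⇒embedding (suc k) (outside ∷ p) k<∣p∣
  with largeSubset⇒embedding (suc k) p k<∣p∣
... | f , f-inj , f∈p = suc ∘ f , f-inj ∘ fsuc-injective , there ∘ f∈p
largeSubset⇒embedding (suc k) (inside ∷ p) (s≤s k≤∣p∣)
  with largeSubset⇒embedding k p k≤∣p∣
... | f , f-inj , f∈p = extend f , extend-injective f-inj , member
  where
  member : ∀ i → extend f i ∈ inside ∷ p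
  member zero    = here
  member (suc i) = there (f∈p i)

-- Consequences of being randomly 3-dimensional: every three distinct
-- vertices resolve G, and no two vertices do.

module RandomlyThreeDimensional {n : ℕ} (G : Graph n) (random : RandomlyDim G 3) where

  open Distance G

  resolvedByTriple : ∀ {a b c u w} → a ≢ b → a ≢ c → b ≢ c →
    d u a ≡ d w a → d u b ≡ d w b → d u c ≡ d w c → u ≡ w
  resolvedByTriple {a} {b} {c} {u} {w} a≢b a≢c b≢c ua ub uc =
    proj₁ (proj₂ random (tripleSet a b c) (∣tripleSet∣ a≢b a≢c b≢c)) u w agree
    where
    agree : ∀ x → x ∈ tripleSet a b c → d u x ≡ d w x
    agree x x∈ with ∈tripleSet⁻ x∈
    ... | inj₁ refl        = ua
    ... | inj₂ (inj₁ refl) = ub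
    ... | inj₂ (inj₂ refl) = uc

  noPairDecoder : ∀ {a b} → a ≢ b → (decode : ℕ → ℕ → Fin n) →
    (∀ u → decode (d u a) (d u b) ≡ u) → ⊥
  noPairDecoder {a} {b} a≢b decode decodes with proj₂ (proj₁ random) (pairSet a b) resolves
    where
    resolves : Resolving G (pairSet a b)
    resolves u w agree = begin
      u                           ≡⟨ sym (decodes u) ⟩
      decode (d u a) (d u b)      ≡⟨ cong₂ decode (agree a (x∈p∪q⁺ (inj₁ (x∈⁅x⁆ a)))) (agree b (x∈p∪q⁺ (inj₂ (x∈⁅x⁆ b)))) ⟩
      decode (d w a) (d w b)      ≡⟨ decodes w ⟩
      w                           ∎
      where open ≡-Reasoning
  ... | 3≤size rewrite ∣pairSet∣ a≢b = contradiction 3≤size λ { (s≤s (s≤s ())) }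

-- Graphs on four vertices: each has a twin pair or is an induced P4.

Distinct₄ : {A : Set} → A → A → A → A → Set
Distinct₄ a b c e = a ≢ b × a ≢ c × a ≢ e × b ≢ c × b ≢ e × c ≢ e

distinct₄-map : ∀ {A B : Set} {f : A → B} {a b c e} → Injective _≡_ _≡_ f →
  Distinct₄ a b c e → Distinct₄ (f a) (f b) (f c) (f e)
distinct₄-map inj (ab , ac , ae , bc , be , ce) =
  ab ∘ inj , ac ∘ inj , ae ∘ inj , bc ∘ inj , be ∘ inj , ce ∘ inj

distinct₄? : (a b c e : Fin 4) → Dec (Distinct₄ a b c e)
distinct₄? a b c e =
  ¬? (a ≟ b) ×-dec ¬? (a ≟ c) ×-dec ¬? (a ≟ e) ×-dec ¬? (b ≟ c) ×-dec ¬? (b ≟ e) ×-dec ¬? (c ≟ e)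

TwinPair : (Fin 4 → Fin 4 → Bool) → Set
TwinPair h = ∃ λ i → ∃ λ j → ∃ λ k → ∃ λ l →
  Distinct₄ i j k l × h i k ≡ h j k × h i l ≡ h j l

InducedP4 : (Fin 4 → Fin 4 → Bool) → Set
InducedP4 h = ∃ λ i → ∃ λ j → ∃ λ k → ∃ λ l → Distinct₄ i j k l ×
  T (h i j) × T (h j k) × T (h k l) × ¬ T (h i k) × ¬ T (h i l) × ¬ T (h j l)

Shape : (Fin 4 → Fin 4 → Bool) → Set
Shape h = TwinPair h ⊎ InducedP4 h

shape? : ∀ h → Dec (Shape h)
shape? h = twin? ⊎-dec path?
  where
  twin? = any? λ i → any? λ j → any? λ k → any? λ l →
    distinct₄? i j k l ×-dec h i k ≟ᵇ h j k ×-dec h i l ≟ᵇ h j l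
  path? = any? λ i → any? λ j → any? λ k → any? λ l → distinct₄? i j k l ×-dec
    T? (h i j) ×-dec T? (h j k) ×-dec T? (h k l) ×-dec
    ¬? (T? (h i k)) ×-dec ¬? (T? (h i l)) ×-dec ¬? (T? (h j l))

shape-cong : ∀ {h h′} → (∀ i j → h i j ≡ h′ i j) → Shape h → Shape h′
shape-cong h≗h′ (inj₁ (i , j , k , l , ds , ik , il)) =
  inj₁ (i , j , k , l , ds , trans (sym (h≗h′ i k)) (trans ik (h≗h′ j k)) ,
                            trans (sym (h≗h′ i l)) (trans il (h≗h′ j l)))
shape-cong {h} {h′} h≗h′ (inj₂ (i , j , k , l , ds , ij , jk , kl , i≁k , i≁l , j≁l)) =
  inj₂ (i , j , k , l , ds , to ij , to jk , to kl , i≁k ∘ from , i≁l ∘ from , j≁l ∘ from)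
  where
  to : ∀ {x y} → T (h x y) → T (h′ x y)
  to = subst T (h≗h′ _ _)
  from : ∀ {x y} → T (h′ x y) → T (h x y)
  from = subst T (sym (h≗h′ _ _))

pattern 0F = zero
pattern 1F = suc zero
pattern 2F = suc (suc zero)
pattern 3F = suc (suc (suc zero))

table : Subset 6 → Fin 4 → Fin 4 → Bool
table (e01 ∷ e02 ∷ e03 ∷ e12 ∷ e13 ∷ e23 ∷ []) = entry
  where
  entry : Fin 4 → Fin 4 → Bool
  entry 0F 1F = e01
  entry 0F 2F = e02
  entry 0F 3F = e03
  entry 1F 0F = e01
  entry 1F 2F = e12
  entry 1F 3F = e13
  entry 2F 0F = e02
  entry 2F 1F = e12
  entry 2F 3F = e23
  entry 3F 0F = e03
  entry 3F 1F = e13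
  entry 3F 2F = e23
  entry _  _  = false

edgeBits : Graph 4 → Subset 6
edgeBits H = adj H 0F 1F ∷ adj H 0F 2F ∷ adj H 0F 3F ∷ adj H 1F 2F ∷ adj H 1F 3F ∷ adj H 2F 3F ∷ []

table-edgeBits : (H : Graph 4) → ∀ i j → table (edgeBits H) i j ≡ adj H i j
table-edgeBits H 0F 0F = sym (adj-irr H 0F)
table-edgeBits H 0F 1F = refl
table-edgeBits H 0F 2F = refl
table-edgeBits H 0F 3F = refl
table-edgeBits H 1F 0F = adj-sym H 0F 1F
table-edgeBits H 1F 1F = sym (adj-irr H 1F)
table-edgeBits H 1F 2F = refl
table-edgeBits H 1F 3F = refl
table-edgeBits H 2F 0F = adj-sym H 0F 2F
table-edgeBits H 2F 1F = adj-sym H 1F 2F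
table-edgeBits H 2F 2F = sym (adj-irr H 2F)
table-edgeBits H 2F 3F = refl
table-edgeBits H 3F 0F = adj-sym H 0F 3F
table-edgeBits H 3F 1F = adj-sym H 1F 3F
table-edgeBits H 3F 2F = adj-sym H 2F 3F
table-edgeBits H 3F 3F = sym (adj-irr H 3F)

-- checked by evaluating the decision procedure on all 64 edge sets
everyTableShaped : ∀ e → Shape (table e)
everyTableShaped e = decidable-stable (shape? (table e)) (λ unshaped → noCounterexample (e , unshaped))
  where
  noCounterexample : ¬ ∃ λ e → ¬ Shape (table e)
  noCounterexample = toWitnessFalse {a? = anySubset? (λ e → ¬? (shape? (table e)))} _

fourVertexGraphs : (H : Graph 4) → Shape (adj H)
fourVertexGraphs H = shape-cong (table-edgeBits H) (everyTableShaped (edgeBits H))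

induced : ∀ {k n} → Graph n → (Fin k → Fin n) → Graph k
induced G x = record
  { adj     = λ i j → adj G (x i) (x j)
  ; adj-sym = λ i j → adj-sym G (x i) (x j)
  ; adj-irr = λ i → adj-irr G (x i)
  }

-- First obstruction: two neighbours of v that see two further neighbours
-- of v alike have equal distances to v and to those two, which form a basis.

module TwinObstruction {n : ℕ} (G : Graph n) (random : RandomlyDim G 3) where

  open Distance G
  open RandomlyThreeDimensional G random

  twinNeighbours : ∀ {v a b c e} → Distinct₄ a b c e →
    T (adj G v a) → T (adj G v b) → T (adj G v c) → T (adj G v e) →
    adj G a c ≡ adj G b c → adj G a e ≡ adj G b e → ⊥
  twinNeighbours {v} {a} {b} (a≢b , a≢c , a≢e , b≢c , b≢e , c≢e) v~a v~b v~c v~e ac≡bc ae≡be =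
    a≢b (resolvedByTriple (adj⇒≢ v~c) (adj⇒≢ v~e) c≢e
           (trans (dist-adj (adj-symᵀ v~a)) (sym (dist-adj (adj-symᵀ v~b))))
           (sameDistance v~c a≢c b≢c ac≡bc) (sameDistance v~e a≢e b≢e ae≡be))
    where
    -- the distance between two neighbours of v is determined by their adjacency
    sameDistance : ∀ {x} → T (adj G v x) → a ≢ x → b ≢ x → adj G a x ≡ adj G b x → d a x ≡ d b x
    sameDistance {x} v~x a≢x b≢x same = begin
      d a x                           ≡⟨ dist-cone v~a v~x a≢x ⟩
      (if adj G a x then 1 else 2)    ≡⟨ cong (if_then 1 else 2) same ⟩
      (if adj G b x then 1 else 2)    ≡⟨ sym (dist-cone v~b v~x b≢x) ⟩
      d b x                           ∎
      where open ≡-Reasoning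

-- Second obstruction: a vertex v adjacent to every vertex of an induced
-- path e₁ i₁ i₂ e₂ (together, a gem).

module GemObstruction {n : ℕ} (G : Graph n) (random : RandomlyDim G 3)
  {v e₁ i₁ i₂ e₂ : Fin n} (distinct : Distinct₄ e₁ i₁ i₂ e₂)
  (v~e₁ : T (adj G v e₁)) (v~i₁ : T (adj G v i₁)) (v~i₂ : T (adj G v i₂)) (v~e₂ : T (adj G v e₂))
  (e₁~i₁ : T (adj G e₁ i₁)) (i₁~i₂ : T (adj G i₁ i₂)) (i₂~e₂ : T (adj G i₂ e₂))
  (e₁≁i₂ : ¬ T (adj G e₁ i₂)) (e₁≁e₂ : ¬ T (adj G e₁ e₂)) (i₁≁e₂ : ¬ T (adj G i₁ e₂)) where

  open Distance G
  open RandomlyThreeDimensional G random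

  e₁≢i₁ : e₁ ≢ i₁
  e₁≢i₁ = proj₁ distinct
  e₁≢i₂ : e₁ ≢ i₂
  e₁≢i₂ = proj₁ (proj₂ distinct)
  e₁≢e₂ : e₁ ≢ e₂
  e₁≢e₂ = proj₁ (proj₂ (proj₂ distinct))
  i₁≢i₂ : i₁ ≢ i₂
  i₁≢i₂ = proj₁ (proj₂ (proj₂ (proj₂ distinct)))
  i₁≢e₂ : i₁ ≢ e₂
  i₁≢e₂ = proj₁ (proj₂ (proj₂ (proj₂ (proj₂ distinct))))
  i₂≢e₂ : i₂ ≢ e₂
  i₂≢e₂ = proj₂ (proj₂ (proj₂ (proj₂ (proj₂ distinct))))

  d-v-e₁ : d v e₁ ≡ 1
  d-v-e₁ = dist-adj v~e₁
  d-v-i₁ : d v i₁ ≡ 1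
  d-v-i₁ = dist-adj v~i₁
  d-v-i₂ : d v i₂ ≡ 1
  d-v-i₂ = dist-adj v~i₂
  d-v-e₂ : d v e₂ ≡ 1
  d-v-e₂ = dist-adj v~e₂
  d-i₁-v : d i₁ v ≡ 1
  d-i₁-v = dist-adj (adj-symᵀ v~i₁)
  d-i₂-v : d i₂ v ≡ 1
  d-i₂-v = dist-adj (adj-symᵀ v~i₂)
  d-e₁-i₁ : d e₁ i₁ ≡ 1
  d-e₁-i₁ = dist-adj e₁~i₁
  d-i₁-e₁ : d i₁ e₁ ≡ 1
  d-i₁-e₁ = dist-adj (adj-symᵀ e₁~i₁)
  d-i₁-i₂ : d i₁ i₂ ≡ 1
  d-i₁-i₂ = dist-adj i₁~i₂
  d-i₂-i₁ : d i₂ i₁ ≡ 1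
  d-i₂-i₁ = dist-adj (adj-symᵀ i₁~i₂)
  d-i₂-e₂ : d i₂ e₂ ≡ 1
  d-i₂-e₂ = dist-adj i₂~e₂
  d-e₂-i₂ : d e₂ i₂ ≡ 1
  d-e₂-i₂ = dist-adj (adj-symᵀ i₂~e₂)
  d-e₁-i₂ : d e₁ i₂ ≡ 2
  d-e₁-i₂ = dist-two e₁≢i₂ e₁≁i₂ v~e₁ v~i₂
  d-i₂-e₁ : d i₂ e₁ ≡ 2
  d-i₂-e₁ = dist-two (≢-sym e₁≢i₂) (e₁≁i₂ ∘ adj-symᵀ) v~i₂ v~e₁
  d-i₁-e₂ : d i₁ e₂ ≡ 2
  d-i₁-e₂ = dist-two i₁≢e₂ i₁≁e₂ v~i₁ v~e₂
  d-e₂-i₁ : d e₂ i₁ ≡ 2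
  d-e₂-i₁ = dist-two (≢-sym i₁≢e₂) (i₁≁e₂ ∘ adj-symᵀ) v~e₂ v~i₁
  d-e₂-e₁ : d e₂ e₁ ≡ 2
  d-e₂-e₁ = dist-two (≢-sym e₁≢e₂) (e₁≁e₂ ∘ adj-symᵀ) v~e₂ v~e₁

  data Gem : Fin n → Set where
    apex : Gem v
    end₁ : Gem e₁
    mid₁ : Gem i₁
    mid₂ : Gem i₂
    end₂ : Gem e₂

  Outside : Fin n → Set
  Outside u = u ≢ v × u ≢ e₁ × u ≢ i₁ × u ≢ i₂ × u ≢ e₂

  outside? : ∀ u → Dec (Outside u)
  outside? u = ¬? (u ≟ v) ×-dec ¬? (u ≟ e₁) ×-dec ¬? (u ≟ i₁) ×-dec ¬? (u ≟ i₂) ×-dec ¬? (u ≟ e₂)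

  place : ∀ u → Gem u ⊎ Outside u
  place u with u ≟ v | u ≟ e₁ | u ≟ i₁ | u ≟ i₂ | u ≟ e₂
  ... | yes refl | _        | _        | _        | _        = inj₁ apex
  ... | no _     | yes refl | _        | _        | _        = inj₁ end₁
  ... | no _     | no _     | yes refl | _        | _        = inj₁ mid₁
  ... | no _     | no _     | no _     | yes refl | _        = inj₁ mid₂
  ... | no _     | no _     | no _     | no _     | yes refl = inj₁ end₂
  ... | no u≢v   | no u≢e₁  | no u≢i₁  | no u≢i₂  | no u≢e₂  = inj₂ (u≢v , u≢e₁ , u≢i₁ , u≢i₂ , u≢e₂)

  -- v and i₁ agree on e₁ and i₂, so every further vertex separates them
  v/i₁-separated : ∀ {u} → u ≢ e₁ → u ≢ i₂ → d u v ≢ d u i₁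
  v/i₁-separated {u} u≢e₁ u≢i₂ eq = adj⇒≢ v~i₁
    (resolvedByTriple e₁≢i₂ (≢-sym u≢e₁) (≢-sym u≢i₂)
      (trans d-v-e₁ (sym d-i₁-e₁)) (trans d-v-i₂ (sym d-i₁-i₂))
      (trans (dist-sym v u) (trans eq (dist-sym u i₁))))

  -- v and i₂ agree on i₁ and e₂, so every further vertex separates them
  v/i₂-separated : ∀ {u} → u ≢ i₁ → u ≢ e₂ → d u v ≢ d u i₂
  v/i₂-separated {u} u≢i₁ u≢e₂ eq = adj⇒≢ v~i₂
    (resolvedByTriple i₁≢e₂ (≢-sym u≢i₁) (≢-sym u≢e₂)
      (trans d-v-i₁ (sym d-i₂-i₁)) (trans d-v-e₂ (sym d-i₂-e₂))
      (trans (dist-sym v u) (trans eq (dist-sym u i₂))))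

  -- an outside vertex is at the same distance from i₁ and i₂: both are
  -- within one of its distance t to v, differ from t, and differ by at most one
  mids-equidistant : ∀ {u} → Outside u → d u i₁ ≡ d u i₂
  mids-equidistant {u} (_ , u≢e₁ , u≢i₁ , u≢i₂ , u≢e₂) =
    close-off-centre (dist-close u v~i₁) (dist-close u v~i₂) (dist-close u (adj-symᵀ i₁~i₂))
      (v/i₁-separated u≢e₁ u≢i₂ ∘ sym) (v/i₂-separated u≢i₁ u≢e₂ ∘ sym)

  -- two outside vertices would, with v, fail to separate i₁ from i₂
  atMostOneOutside : ∀ {u u′} → Outside u → Outside u′ → u ≡ u′
  atMostOneOutside {u} {u′} out out′ with u ≟ u′
  ... | yes u≡u′ = u≡u′
  ... | no  u≢u′ = contradiction
    (resolvedByTriple (≢-sym (proj₁ out)) (≢-sym (proj₁ out′)) u≢u′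
       (trans d-i₁-v (sym d-i₂-v)) (mids-seen out) (mids-seen out′))
    i₁≢i₂
    where
    mids-seen : ∀ {x} → Outside x → d i₁ x ≡ d i₂ x
    mids-seen {x} o = trans (dist-sym i₁ x) (trans (mids-equidistant o) (dist-sym x i₂))

  -- recovering a vertex from its distances to e₁ and e₂; z is the fallback
  decodeEnds : Fin n → ℕ → ℕ → Fin n
  decodeEnds z 0       _ = e₁
  decodeEnds z (suc _) 0 = e₂
  decodeEnds z 1       1 = v
  decodeEnds z 1       2 = i₁
  decodeEnds z 2       1 = i₂
  decodeEnds z _       _ = z

  decodeEnds-gem : ∀ z {u} → Gem u → decodeEnds z (d u e₁) (d u e₂) ≡ u
  decodeEnds-gem z apex rewrite d-v-e₁ | d-v-e₂ = refl
  decodeEnds-gem z end₁ rewrite dist-refl e₁ = refl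
  decodeEnds-gem z mid₁ rewrite d-i₁-e₁ | d-i₁-e₂ = refl
  decodeEnds-gem z mid₂ rewrite d-i₂-e₁ | d-i₂-e₂ = refl
  decodeEnds-gem z end₂ rewrite d-e₂-e₁ | dist-refl e₂ = refl

  decodeMids : Fin n → ℕ → ℕ → Fin n
  decodeMids z 0       _ = i₁
  decodeMids z (suc _) 0 = i₂
  decodeMids z 1       1 = v
  decodeMids z 1       2 = e₁
  decodeMids z 2       1 = e₂
  decodeMids z _       _ = z

  decodeMids-gem : ∀ z {u} → Gem u → decodeMids z (d u i₁) (d u i₂) ≡ u
  decodeMids-gem z apex rewrite d-v-i₁ | d-v-i₂ = refl
  decodeMids-gem z end₁ rewrite d-e₁-i₁ | d-e₁-i₂ = refl
  decodeMids-gem z mid₁ rewrite dist-refl i₁ = refl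
  decodeMids-gem z mid₂ rewrite d-i₂-i₁ | dist-refl i₂ = refl
  decodeMids-gem z end₂ rewrite d-e₂-i₁ | d-e₂-i₂ = refl

  decodeMids-beyond : ∀ z k → decodeMids z (2 + k) (2 + k) ≡ z
  decodeMids-beyond z zero    = refl
  decodeMids-beyond z (suc k) = refl

  -- the distances to e₁, e₂ tell the gem vertices apart, so some vertex lies outside
  outsideVertex : ∃ Outside
  outsideVertex with any? outside?
  ... | yes found = found
  ... | no  none  = ⊥-elim (noPairDecoder e₁≢e₂ (decodeEnds v) decodes)
    where
    decodes : ∀ u → decodeEnds v (d u e₁) (d u e₂) ≡ u
    decodes u = [ decodeEnds-gem v , (λ out → contradiction (u , out) none) ]′ (place u)

  w : Fin n
  w = proj₁ outsideVertex

  w-outside : Outside w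
  w-outside = proj₂ outsideVertex

  w≢v : w ≢ v
  w≢v = proj₁ w-outside
  w≢e₁ : w ≢ e₁
  w≢e₁ = proj₁ (proj₂ w-outside)
  w≢i₁ : w ≢ i₁
  w≢i₁ = proj₁ (proj₂ (proj₂ w-outside))
  w≢e₂ : w ≢ e₂
  w≢e₂ = proj₂ (proj₂ (proj₂ (proj₂ w-outside)))

  everyVertex : ∀ u → Gem u ⊎ u ≡ w
  everyVertex u = map₂ (λ out → atMostOneOutside out w-outside) (place u)

  -- w is adjacent to i₁: otherwise distances to i₁, i₂ would tell all vertices apart
  w-i₁ : d w i₁ ≡ 1
  w-i₁ = atOne (d w i₁) refl (sym (mids-equidistant w-outside))
    where
    atOne : ∀ c → d w i₁ ≡ c → d w i₂ ≡ c → c ≡ 1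
    atOne 0 at₁ _ = contradiction (dist-zero at₁) w≢i₁
    atOne 1 _ _ = refl
    atOne (suc (suc k)) at₁ at₂ = ⊥-elim (noPairDecoder i₁≢i₂ (decodeMids w) decodes)
      where
      decodes : ∀ u → decodeMids w (d u i₁) (d u i₂) ≡ u
      decodes u = [ decodeMids-gem w
                  , (λ { refl → trans (cong₂ (decodeMids w) at₁ at₂) (decodeMids-beyond w k) }) ]′
                  (everyVertex u)

  w-i₂ : d w i₂ ≡ 1
  w-i₂ = trans (sym (mids-equidistant w-outside)) w-i₁

  -- w and v agree on i₁ and i₂, so an end e (adjacent to some i, and to v)
  -- separates them; hence d w e = 2
  w-end : ∀ {e i} → T (adj G i e) → d w i ≡ 1 → i₁ ≢ e → i₂ ≢ e → w ≢ e → d v e ≡ 1 → d w e ≡ 2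
  w-end {e} {i} i~e w-i i₁≢e i₂≢e w≢e v-e = exactlyTwo near (w≢e ∘ dist-zero) separated
    where
    near : d w e ≤ 2
    near = subst (λ k → d w e ≤ suc k) w-i (dist-lipschitz w i~e)
    separated : d w e ≢ 1
    separated w-e = w≢v
      (resolvedByTriple i₁≢i₂ i₁≢e i₂≢e
        (trans w-i₁ (sym d-v-i₁)) (trans w-i₂ (sym d-v-i₂)) (trans w-e (sym v-e)))

  w-e₁ : d w e₁ ≡ 2
  w-e₁ = w-end (adj-symᵀ e₁~i₁) w-i₁ (≢-sym e₁≢i₁) (≢-sym e₁≢i₂) w≢e₁ d-v-e₁

  w-e₂ : d w e₂ ≡ 2
  w-e₂ = w-end i₂~e₂ w-i₂ i₁≢e₂ i₂≢e₂ w≢e₂ d-v-e₂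

  -- now the distances to e₁ and e₂ tell all vertices apart
  impossible : ⊥
  impossible = noPairDecoder e₁≢e₂ (decodeEnds w) decodes
    where
    decodes : ∀ u → decodeEnds w (d u e₁) (d u e₂) ≡ u
    decodes u = [ decodeEnds-gem w , (λ { refl → cong₂ (decodeEnds w) w-e₁ w-e₂ }) ]′ (everyVertex u)

module DegreeBound {n : ℕ} (G : Graph n) (random : RandomlyDim G 3) where

  open TwinObstruction G random

  fourNeighbours : ∀ {v} → 4 ≤ degree G v →
    ∃ λ (x : Fin 4 → Fin n) → Injective _≡_ _≡_ x × (∀ i → T (adj G v (x i)))
  fourNeighbours {v} large with largeSubset⇒embedding 4 (tabulate (adj G v)) large
  ... | x , x-injective , x∈N = x , x-injective , λ i →
    Equivalence.from T-≡ (trans (sym (lookup∘tabulate (adj G v) (x i))) ([]=⇒lookup (x∈N i)))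

  noDegreeFour : ∀ v → 4 ≤ degree G v → ⊥
  noDegreeFour v large with fourNeighbours large
  ... | x , x-injective , v~x = obstruction (fourVertexGraphs (induced G x))
    where
    obstruction : Shape (adj (induced G x)) → ⊥
    obstruction (inj₁ (i , j , k , l , ds , ik , il)) =
      twinNeighbours (distinct₄-map x-injective ds) (v~x i) (v~x j) (v~x k) (v~x l) ik il
    obstruction (inj₂ (i , j , k , l , ds , ij , jk , kl , i≁k , i≁l , j≁l)) =
      GemObstruction.impossible G random (distinct₄-map x-injective ds)
        (v~x i) (v~x j) (v~x k) (v~x l) ij jk kl i≁k i≁l j≁l

mainTheorem14 : (n : ℕ) (G : Graph n) → Connected G → RandomlyDim G 3 → MaxDegreeAtMost G 3
mainTheorem14 n G _ random v with degree G v ≤? 3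
... | yes small = small
... | no  large = ⊥-elim (DegreeBound.noDegreeFour G random v (≰⇒> large))
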